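{- Let $\Delta\geq1$ and $k$ be integers with $1\leq k\leq \Delta/2+3/2$, and let $m\geq k(\Delta-k+3)$. Then there is a deterministic one-round algorithm that, on any graph of maximum degree at most $\Delta$ given with a proper input $m$-coloring, computes a proper $(m-k)$-coloring; in particular, for $m=k(\Delta-k+3)$ it reduces the input coloring to a proper coloring with $k(\Delta-k+2)$ colors.
   Context: Setting: each vertex initially knows only its own color in a proper input coloring with colors $\{0,\ldots,m-1\}$, together with $m$, $\Delta$, $k$; there are no unique identifiers. In one communication round each vertex learns the input colors of its neighbors, so a one-round algorithm maps a vertex's own input color and its neighbors' input colors to an output color. A coloring is proper if adjacent vertices get different colors. -}

module Defs where

open import Data.Nat using (ℕ; zero; suc; _≤_)
open import Data.Bool using (Bool; true; false; _∧_; _∨_)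
open import Data.Fin using (Fin; zero; suc; _≟_)
open import Data.Fin.Subset using (Subset; ∣_∣)
open import Data.Vec using (tabulate)
open import Relation.Nullary.Decidable using (⌊_⌋)
open import Relation.Binary.PropositionalEquality using (_≡_; _≢_)

anyFin : (n : ℕ) → (Fin n → Bool) → Bool
anyFin zero    p = false
anyFin (suc n) p = p zero ∨ anyFin n (λ i → p (suc i))

record Graph : Set where
  field
    n     : ℕ
    Adj   : Fin n → Fin n → Bool
    sym   : ∀ u v → Adj u v ≡ true → Adj v u ≡ true
    irrefl : ∀ u → Adj u u ≡ false

open Graph public

nbhd : (G : Graph) → Fin (n G) → Subset (n G)
nbhd G u = tabulate (Adj G u)

degree : (G : Graph) → Fin (n G) → ℕ
degree G u = ∣ nbhd G u ∣

MaxDegreeAtMost : Graph → ℕ → Set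
MaxDegreeAtMost G Δ = ∀ u → degree G u ≤ Δ

Coloring : Graph → ℕ → Set
Coloring G c = Fin (n G) → Fin c

Proper : (G : Graph) {c : ℕ} → Coloring G c → Set
Proper G col = ∀ u v → Adj G u v ≡ true → col u ≢ col v

neighbourColors : (G : Graph) {m : ℕ} → Coloring G m → Fin (n G) → Subset m
neighbourColors G col u =
  tabulate (λ c → anyFin (n G) (λ v → Adj G u v ∧ ⌊ col v ≟ c ⌋))

-- A deterministic one-round algorithm from m input colors to c output colors:
-- maps own input color and the neighbours' input colors to an output color.
OneRoundAlg : ℕ → ℕ → Set
OneRoundAlg m c = Fin m → Subset m → Fin c

run : {m c : ℕ} → OneRoundAlg m c → (G : Graph) → Coloring G m → Coloring G c
run A G col u = A (col u) (neighbourColors G col u)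

-- Keep the input colours below N = m − k and recolour each of the k top colours i into Fin N with
-- the first of Δ + 1 candidates that no neighbour's input colour forbids; as every input colour forbids
-- at most one candidate of i, the at most Δ neighbours cannot forbid them all.  Fin N contains k blocks of Δ + 2 − k
-- colours.  The candidates of i are the colours of its own block and, for each other top colour j,
-- the colour that j's block reserves for the pair (j, i), which i may use only if no neighbour has
-- input colour j.  A candidate equal to a kept colour x is forbidden by x itself, and two distinct top
-- colours can only meet on a reserved pair colour, where the borrower sees the owner next to it.
-- The blocks use k (Δ + 2 − k) = k (Δ + 3 − k) − k ≤ N colours.
module Submission where

open import Defs hiding (sym)
open import Data.Nat using (ℕ; _≤_; _<_; _+_; _*_; _∸_; zero; suc; z≤n; s≤s)
open import Data.Nat.Properties
  using (≤-trans; +-assoc; ≤-reflexive; <⇒≱; *-suc; +-comm; +-suc; +-cancelˡ-≤; m+[n∸m]≡n; m+n∸m≡n; m∸n+n≡m; m+n≤o⇒n≤o; m+n≤o⇒m≤o∸n)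
open import Data.Bool using (true; false; _∧_)
open import Data.Fin using (Fin; zero; suc; _≟_; _↑ˡ_; splitAt; join; combine; inject≤; fromℕ<; punchIn; punchOut)
open import Data.Fin.Properties
  using (any?; suc-injective; 0≢1+n; join-splitAt; combine-injective; inject≤-injective; ↑ˡ-injective; punchIn-injective; punchInᵢ≢i; punchOut-injective)
open import Data.Fin.Subset using (Subset; ∣_∣; _∈_; _-_)
open import Data.Fin.Subset.Properties using (_∈?_; x∈p∧x≢y⇒x∈p-y; x∈p⇒∣p-x∣<∣p∣)
open import Data.List using (List; []; _∷_)
open import Data.List.Relation.Unary.Any using (here; there)
import Data.List.Membership.DecPropositional as ListMembership
open import Data.Vec.Properties using (lookup∘tabulate; []=⇒lookup; lookup⇒[]=)
open import Data.Product using (Σ; ∃; _×_; _,_; proj₁; proj₂)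
open import Data.Sum using (_⊎_; inj₁; inj₂; [_,_])
import Data.Sum as Sum
open import Data.Sum.Properties using (inj₁-injective; inj₂-injective; ≡-dec)
open import Data.Empty using (⊥-elim)
open import Function using (_∘_)
open import Function.Definitions using (Injective)
open import Relation.Nullary using (¬_; Dec; yes; no; ¬?; _×-dec_; contradiction)
open import Relation.Nullary.Decidable using (⌊_⌋; decidable-stable)
open import Relation.Binary.PropositionalEquality
  using (_≡_; _≢_; refl; sym; trans; cong; subst; subst₂; module ≡-Reasoning)
open import Data.Nat.Tactic.RingSolver using (solve-∀)

anyFin⇒∃ : ∀ n p → anyFin n p ≡ true → ∃ λ i → p i ≡ true
anyFin⇒∃ (suc n) p h with p zero in eq
... | true = zero , eq
... | false with anyFin⇒∃ n (p ∘ suc) h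
...   | i , pi = suc i , pi

∃⇒anyFin : ∀ n p i → p i ≡ true → anyFin n p ≡ true
∃⇒anyFin (suc n) p zero    h rewrite h = refl
∃⇒anyFin (suc n) p (suc i) h with p zero
... | true  = refl
... | false = ∃⇒anyFin n (p ∘ suc) i h

module _ (G : Graph) where

  adjacent⇒∈nbhd : ∀ {u w} → Adj G u w ≡ true → w ∈ nbhd G u
  adjacent⇒∈nbhd {u} {w} uw = lookup⇒[]= w _ (trans (lookup∘tabulate (Adj G u) w) uw)

  module _ {m : ℕ} (col : Coloring G m) where

    adjacent⇒∈neighbourColors : ∀ {u w} → Adj G u w ≡ true → col w ∈ neighbourColors G col u
    adjacent⇒∈neighbourColors {u} {w} uw =
      lookup⇒[]= (col w) _ (trans (lookup∘tabulate _ (col w)) (∃⇒anyFin (n G) _ w seen))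
      where
      seen : (Adj G u w ∧ ⌊ col w ≟ col w ⌋) ≡ true
      seen rewrite uw with col w ≟ col w
      ... | yes _ = refl
      ... | no c≢c = contradiction refl c≢c

    ∈neighbourColors⇒adjacent : ∀ {u c} → c ∈ neighbourColors G col u →
                                ∃ λ w → Adj G u w ≡ true × col w ≡ c
    ∈neighbourColors⇒adjacent {u} {c} c∈ with anyFin⇒∃ (n G) _ (trans (sym (lookup∘tabulate _ c)) ([]=⇒lookup c∈))
    ... | w , seen with Adj G u w in uw | col w ≟ c
    ...   | true | yes wc = w , uw , wc

injective⇒≤∣p∣ : ∀ {a n} {p : Subset n} (f : Fin a → Fin n) → Injective _≡_ _≡_ f → (∀ i → f i ∈ p) → a ≤ ∣ p ∣
injective⇒≤∣p∣ {zero}  f f-inj f∈p = z≤n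
injective⇒≤∣p∣ {suc a} {p = p} f f-inj f∈p =
  ≤-trans (s≤s (injective⇒≤∣p∣ (f ∘ suc) (suc-injective ∘ f-inj) f∘suc∈p-f₀)) (x∈p⇒∣p-x∣<∣p∣ (f∈p zero))
  where
  f∘suc∈p-f₀ : ∀ i → f (suc i) ∈ p - f zero
  f∘suc∈p-f₀ i = x∈p∧x≢y⇒x∈p-y (f∈p (suc i)) (0≢1+n ∘ sym ∘ f-inj)

OneRoundReduction : (m c Δ : ℕ) → Set
OneRoundReduction m c Δ =
  Σ (OneRoundAlg m c) λ A → (G : Graph) (col : Coloring G m) → MaxDegreeAtMost G Δ →
  Proper G col → Proper G (run A G col)

-- Candidate s of input colour a may be output unless some neighbour has an input colour b with
-- Blocks a s b.
record CandidateScheme (m L c : ℕ) : Set₁ where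
  field
    candidate     : Fin m → Fin L → Fin c
    Blocks        : Fin m → Fin L → Fin m → Set
    blocks?       : ∀ a s b → Dec (Blocks a s b)
    blocks-unique : ∀ {a b s s′} → Blocks a s b → Blocks a s′ b → s ≡ s′
    clash-blocked : ∀ {a b s t} → a ≢ b → candidate a s ≡ candidate b t → Blocks a s b ⊎ Blocks b t a

module _ {m L c : ℕ} (S : CandidateScheme m L c) where
  open CandidateScheme S

  Blocked : Fin m → Subset m → Fin L → Set
  Blocked a X s = ∃ λ b → b ∈ X × Blocks a s b

  blocked? : ∀ a X s → Dec (Blocked a X s)
  blocked? a X s = any? λ b → b ∈? X ×-dec blocks? a s b

  some-candidate-unblocked : ∀ {Δ} → Δ < L → (G : Graph) (col : Coloring G m) → MaxDegreeAtMost G Δ →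
                             ∀ u → ¬ (∀ s → Blocked (col u) (neighbourColors G col u) s)
  some-candidate-unblocked Δ<L G col deg u all-blocked =
    <⇒≱ Δ<L (≤-trans (injective⇒≤∣p∣ blocker blocker-injective blocker∈nbhd) (deg u))
    where
    blocking-neighbour : ∀ s → ∃ λ w → Adj G u w ≡ true × Blocks (col u) s (col w)
    blocking-neighbour s with all-blocked s
    ... | b , b∈X , blocks with ∈neighbourColors⇒adjacent G col b∈X
    ...   | w , uw , refl = w , uw , blocks

    blocker : Fin L → Fin (n G)
    blocker s = proj₁ (blocking-neighbour s)

    blocker∈nbhd : ∀ s → blocker s ∈ nbhd G u
    blocker∈nbhd s = adjacent⇒∈nbhd G (proj₁ (proj₂ (blocking-neighbour s)))

    blocker-injective : Injective _≡_ _≡_ blocker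
    blocker-injective {s} {s′} eq =
      blocks-unique (proj₂ (proj₂ (blocking-neighbour s)))
                    (subst (Blocks (col u) s′ ∘ col) (sym eq) (proj₂ (proj₂ (blocking-neighbour s′))))

  module _ {Δ : ℕ} (Δ<L : Δ < L) where

    choice : Fin m → Subset m → Fin L
    choice a X with any? (λ s → ¬? (blocked? a X s))
    ... | yes (s , _) = s
    ... | no _        = fromℕ< Δ<L

    choice-unblocked : ∀ {a X} → ¬ (∀ s → Blocked a X s) → ¬ Blocked a X (choice a X)
    choice-unblocked {a} {X} not-all with any? (λ s → ¬? (blocked? a X s))
    ... | yes (_ , unblocked) = unblocked
    ... | no none = ⊥-elim (not-all λ s → decidable-stable (blocked? a X s) λ unblocked → none (s , unblocked))

    choose : OneRoundAlg m c
    choose a X = candidate a (choice a X)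

    choose-proper : (G : Graph) (col : Coloring G m) → MaxDegreeAtMost G Δ →
                    Proper G col → Proper G (run choose G col)
    choose-proper G col deg col-proper u v uv same =
      [ (λ v-blocks → unblocked u (col v , adjacent⇒∈neighbourColors G col uv , v-blocks))
      , (λ u-blocks → unblocked v (col u , adjacent⇒∈neighbourColors G col (Graph.sym G u v uv) , u-blocks))
      ] (clash-blocked (col-proper u v uv) same)
      where
      unblocked : ∀ w → ¬ Blocked (col w) (neighbourColors G col w) (choice (col w) (neighbourColors G col w))
      unblocked w = choice-unblocked (some-candidate-unblocked Δ<L G col deg w)

scheme⇒reduction : ∀ {m L c Δ} → CandidateScheme m L c → Δ < L → OneRoundReduction m c Δ
scheme⇒reduction S Δ<L = choose S Δ<L , choose-proper S Δ<L

splitAt-injective : ∀ m {n} {i j : Fin (m + n)} → splitAt m i ≡ splitAt m j → i ≡ j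
splitAt-injective m {n} {i} {j} eq =
  trans (sym (join-splitAt m n i)) (trans (cong (join m n) eq) (join-splitAt m n j))

punchOut-cancel : ∀ {n} {o o′ i j : Fin (suc n)} (o≢i : o ≢ i) (o′≢j : o′ ≢ j) →
                  o ≡ o′ → punchOut o≢i ≡ punchOut o′≢j → i ≡ j
punchOut-cancel o≢i o′≢j refl = punchOut-injective o≢i o′≢j

-- Input colours are viewed in Fin N ⊎ Fin K (inj₁ x is kept).  Slot t < k′ of block a is reserved
-- for the pair (a, punchIn a t); the remaining P slots are used by a alone.
module PairedBlocks (k′ P N : ℕ) (fits : suc k′ * (k′ + P) ≤ N) where

  K : ℕ
  K = suc k′

  block : Fin K → Fin (k′ + P) → Fin N
  block a r = inject≤ (combine a r) fits

  block-injective : ∀ {a a′ r r′} → block a r ≡ block a′ r′ → a ≡ a′ × r ≡ r′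
  block-injective eq = combine-injective _ _ _ _ (inject≤-injective fits fits _ _ eq)

  Choice : Set
  Choice = Fin k′ ⊎ Fin (k′ + P)

  colourOf : Fin K → Choice → Fin N
  colourOf i (inj₁ j′) = block (punchIn i j′) (punchOut (punchInᵢ≢i i j′) ↑ˡ P)
  colourOf i (inj₂ r)  = block i r

  colourOf-injective : ∀ i → Injective _≡_ _≡_ (colourOf i)
  colourOf-injective i {inj₁ j′} {inj₁ j″} eq = cong inj₁ (punchIn-injective i j′ j″ (proj₁ (block-injective eq)))
  colourOf-injective i {inj₁ j′} {inj₂ r′}  eq = contradiction (proj₁ (block-injective eq)) (punchInᵢ≢i i j′)
  colourOf-injective i {inj₂ r}  {inj₁ j″} eq = contradiction (sym (proj₁ (block-injective eq))) (punchInᵢ≢i i j″)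
  colourOf-injective i {inj₂ r}  {inj₂ r′}  eq = cong inj₂ (proj₂ (block-injective {i} {i} eq))

  Input : Set
  Input = Fin N ⊎ Fin K

  open ListMembership (≡-dec (_≟_ {N}) (_≟_ {K})) using () renaming (_∈_ to _∈ˡ_; _∈?_ to _∈ˡ?_)

  lenders : Fin K → Choice → List Input
  lenders i (inj₁ j′) = inj₂ (punchIn i j′) ∷ []
  lenders i (inj₂ r)  = []

  candidateᵛ : Input → Choice → Fin N
  candidateᵛ (inj₁ x) σ = x
  candidateᵛ (inj₂ i) σ = colourOf i σ

  blockersᵛ : Input → Choice → List Input
  blockersᵛ (inj₁ x) σ = []
  blockersᵛ (inj₂ i) σ = inj₁ (colourOf i σ) ∷ lenders i σ

  kept∉lenders : ∀ {x i σ} → ¬ (inj₁ x ∈ˡ lenders i σ)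
  kept∉lenders {σ = inj₁ j′} (here ())
  kept∉lenders {σ = inj₁ j′} (there ())

  lenders-disjoint : ∀ {β i σ σ′} → β ∈ˡ lenders i σ → β ∈ˡ lenders i σ′ → σ ≡ σ′
  lenders-disjoint {i = i} {inj₁ j′} {inj₁ j″} (here refl) (here eq) =
    cong inj₁ (punchIn-injective i j′ j″ (inj₂-injective eq))

  blockers-disjoint : ∀ {α β σ σ′} → β ∈ˡ blockersᵛ α σ → β ∈ˡ blockersᵛ α σ′ → σ ≡ σ′
  blockers-disjoint {inj₂ i} (here refl)  (here eq)    = colourOf-injective i (inj₁-injective eq)
  blockers-disjoint {inj₂ i} (here refl)  (there β∈)   = contradiction β∈ kept∉lenders
  blockers-disjoint {inj₂ i} (there β∈)   (here refl)  = contradiction β∈ kept∉lenders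
  blockers-disjoint {inj₂ i} (there β∈)   (there β∈′)  = lenders-disjoint β∈ β∈′

  recoloured-clash : ∀ {i j σ τ} → i ≢ j → colourOf i σ ≡ colourOf j τ →
                     inj₂ j ∈ˡ lenders i σ ⊎ inj₂ i ∈ˡ lenders j τ
  recoloured-clash {i} {j} {inj₁ j′} {inj₁ j″} i≢j eq with block-injective eq
  ... | same-lender , same-slot =
    contradiction (punchOut-cancel (punchInᵢ≢i i j′) (punchInᵢ≢i j j″) same-lender (↑ˡ-injective P _ _ same-slot)) i≢j
  recoloured-clash {σ = inj₁ j′} {inj₂ r′} i≢j eq = inj₁ (here (cong inj₂ (sym (proj₁ (block-injective eq)))))
  recoloured-clash {σ = inj₂ r}  {inj₁ j″} i≢j eq = inj₂ (here (cong inj₂ (proj₁ (block-injective eq))))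
  recoloured-clash {σ = inj₂ r}  {inj₂ r′} i≢j eq = contradiction (proj₁ (block-injective eq)) i≢j

  clashᵛ : ∀ {α β σ τ} → α ≢ β → candidateᵛ α σ ≡ candidateᵛ β τ →
           β ∈ˡ blockersᵛ α σ ⊎ α ∈ˡ blockersᵛ β τ
  clashᵛ {inj₁ x} {inj₁ y} α≢β eq = contradiction (cong inj₁ eq) α≢β
  clashᵛ {inj₁ x} {inj₂ j} α≢β eq = inj₂ (here (cong inj₁ eq))
  clashᵛ {inj₂ i} {inj₁ y} α≢β eq = inj₁ (here (cong inj₁ (sym eq)))
  clashᵛ {inj₂ i} {inj₂ j} α≢β eq = Sum.map there there (recoloured-clash (α≢β ∘ cong inj₂) eq)

  scheme : CandidateScheme (N + K) (k′ + (k′ + P)) N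
  scheme = record
    { candidate     = λ a s → candidateᵛ (splitAt N a) (splitAt k′ s)
    ; Blocks        = λ a s b → splitAt N b ∈ˡ blockersᵛ (splitAt N a) (splitAt k′ s)
    ; blocks?       = λ a s b → splitAt N b ∈ˡ? blockersᵛ (splitAt N a) (splitAt k′ s)
    ; blocks-unique = λ β∈ β∈′ → splitAt-injective k′ (blockers-disjoint β∈ β∈′)
    ; clash-blocked = λ a≢b → clashᵛ (a≢b ∘ splitAt-injective N)
    }

paired-blocks-reduction : ∀ {Δ} k′ P N → Δ < k′ + (k′ + P) → suc k′ * (k′ + P) ≤ N →
                          OneRoundReduction (N + suc k′) N Δ
paired-blocks-reduction k′ P N Δ<L fits = scheme⇒reduction (PairedBlocks.scheme k′ P N fits) Δ<L

slot-count : ∀ Δ k′ → 2 * suc k′ ≤ Δ + 3 → k′ + (k′ + (Δ + 1 ∸ (k′ + k′))) ≡ suc Δ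
slot-count Δ k′ 2k≤Δ+3 = begin
  k′ + (k′ + (Δ + 1 ∸ (k′ + k′)))  ≡⟨ sym (+-assoc k′ k′ _) ⟩
  k′ + k′ + (Δ + 1 ∸ (k′ + k′))    ≡⟨ m+[n∸m]≡n (+-cancelˡ-≤ 2 _ _ (subst₂ _≤_ (double-suc k′) (plus-three Δ) 2k≤Δ+3)) ⟩
  Δ + 1                            ≡⟨ +-comm Δ 1 ⟩
  suc Δ                            ∎
  where
  open ≡-Reasoning
  double-suc : ∀ k′ → 2 * suc k′ ≡ 2 + (k′ + k′)
  double-suc = solve-∀
  plus-three : ∀ Δ → Δ + 3 ≡ 2 + (Δ + 1)
  plus-three = solve-∀

colour-budget : ∀ Δ k′ P → k′ + (k′ + P) ≡ suc Δ → suc k′ * (Δ + 3 ∸ suc k′) ≡ suc k′ * (k′ + P) + suc k′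
colour-budget Δ k′ P slots = begin
  suc k′ * (Δ + 3 ∸ suc k′)                   ≡⟨ cong (λ x → suc k′ * (x ∸ suc k′)) Δ+3-split ⟩
  suc k′ * (suc k′ + suc (k′ + P) ∸ suc k′)   ≡⟨ cong (suc k′ *_) (m+n∸m≡n (suc k′) _) ⟩
  suc k′ * suc (k′ + P)                       ≡⟨ *-suc (suc k′) _ ⟩
  suc k′ + suc k′ * (k′ + P)                  ≡⟨ +-comm (suc k′) _ ⟩
  suc k′ * (k′ + P) + suc k′                  ∎
  where
  open ≡-Reasoning
  Δ+3-split : Δ + 3 ≡ suc k′ + suc (k′ + P)
  Δ+3-split = begin
    Δ + 3                       ≡⟨ +-comm Δ 3 ⟩
    3 + Δ                       ≡⟨ cong (2 +_) slots ⟨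
    2 + (k′ + (k′ + P))         ≡⟨ cong suc (+-suc k′ (k′ + P)) ⟨
    suc k′ + suc (k′ + P)       ∎

lemma10 : (Δ k m : ℕ) → 1 ≤ Δ → 1 ≤ k → 2 * k ≤ Δ + 3 → k * (Δ + 3 ∸ k) ≤ m →
          Σ (OneRoundAlg m (m ∸ k)) (λ A →
            (G : Graph) (col : Coloring G m) → MaxDegreeAtMost G Δ →
            Proper G col → Proper G (run A G col))
lemma10 Δ zero     m _ () _ _
lemma10 Δ (suc k′) m _ _ 2k≤Δ+3 k[Δ+3-k]≤m =
  subst (λ m′ → OneRoundReduction m′ N Δ) (m∸n+n≡m K≤m)
        (paired-blocks-reduction k′ P N (≤-reflexive (sym slots)) fits)
  where
  P : ℕ
  P = Δ + 1 ∸ (k′ + k′)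
  N : ℕ
  N = m ∸ suc k′
  slots : k′ + (k′ + P) ≡ suc Δ
  slots = slot-count Δ k′ 2k≤Δ+3
  demand : suc k′ * (k′ + P) + suc k′ ≤ m
  demand = subst (_≤ m) (colour-budget Δ k′ P slots) k[Δ+3-k]≤m
  fits : suc k′ * (k′ + P) ≤ N
  fits = m+n≤o⇒m≤o∸n _ demand
  K≤m : suc k′ ≤ m
  K≤m = m+n≤o⇒n≤o _ demand
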